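{- Let $G$ be a $k$-metric dimensional graph and let $k_1,k_2$ be integers with $1\le k_1<k_2\le k$. Then $\dim_{k_1}(G)<\dim_{k_2}(G)$.
   Context: Graphs are finite, simple, connected; $d_G$ is the shortest-path distance. A vertex $w$ distinguishes $x,y$ if $d_G(x,w)\ne d_G(y,w)$; a set $S\subseteq V(G)$ is a $k$-metric generator if every pair of distinct vertices is distinguished by at least $k$ elements of $S$; $\dim_k(G)$ is the minimum cardinality of a $k$-metric generator; $G$ is $k$-metric dimensional if $k$ is the largest integer for which a $k$-metric generator exists. -}

module Defs where

open import Data.Nat using (ℕ; zero; suc; _≤_)
open import Data.Fin using (Fin)
open import Data.Fin.Subset using (Subset; _∈_; _⊆_; ∣_∣)
open import Data.Bool using (Bool; true; false)
open import Data.Product using (Σ; ∃; _×_)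
open import Relation.Binary.PropositionalEquality using (_≡_; _≢_)

data Walk {n : ℕ} (adj : Fin n → Fin n → Bool) : Fin n → Fin n → ℕ → Set where
  here : ∀ {x} → Walk adj x x zero
  step : ∀ {x y z m} → adj x y ≡ true → Walk adj y z m → Walk adj x z (suc m)

record Graph (n : ℕ) : Set where
  field
    adj       : Fin n → Fin n → Bool
    symmetric : ∀ x y → adj x y ≡ adj y x
    irreflexive : ∀ x → adj x x ≡ false
    connected : ∀ x y → ∃ λ m → Walk adj x y m

open Graph public

Dist : ∀ {n} → Graph n → Fin n → Fin n → ℕ → Set
Dist G x y m = Walk (adj G) x y m × (∀ m' → Walk (adj G) x y m' → m ≤ m')

Distinguishes : ∀ {n} → Graph n → Fin n → Fin n → Fin n → Set
Distinguishes G w x y =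
  Σ ℕ λ a → Σ ℕ λ b → Dist G x w a × Dist G y w b × a ≢ b

IsKMetricGenerator : ∀ {n} → Graph n → ℕ → Subset n → Set
IsKMetricGenerator {n} G k S =
  ∀ x y → x ≢ y →
    Σ (Subset n) λ T → T ⊆ S × k ≤ ∣ T ∣ × (∀ {w} → w ∈ T → Distinguishes G w x y)

IsKMetricDimension : ∀ {n} → Graph n → ℕ → ℕ → Set
IsKMetricDimension {n} G k d =
  (Σ (Subset n) λ S → IsKMetricGenerator G k S × ∣ S ∣ ≡ d)
  × (∀ S → IsKMetricGenerator G k S → d ≤ ∣ S ∣)

KMetricDimensional : ∀ {n} → Graph n → ℕ → Set
KMetricDimensional {n} G k =
  (Σ (Subset n) λ S → IsKMetricGenerator G k S)
  × (∀ k' → (Σ (Subset n) λ S → IsKMetricGenerator G k' S) → k' ≤ k)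

-- Idea: let S be a minimum k₂-metric generator, so ∣ S ∣ = dim_{k₂}(G).
-- Deleting one vertex v from a set lowers, for every pair of vertices, the
-- number of distinguishing elements by at most one; hence S - v is a
-- (k₂ - 1)-metric generator and in particular a k₁-metric generator, giving
-- dim_{k₁}(G) ≤ ∣ S - v ∣ < ∣ S ∣ = dim_{k₂}(G).  Such a v exists because S
-- is nonempty: G has two distinct vertices (a graph with at most one vertex
-- admits k-metric generators for every k, so it is not k-metric
-- dimensional), and the pair must be distinguished by some element of S.
--
-- The argument does
-- not need the hypotheses 1 ≤ k₁ and k₂ ≤ k.
module Submission where

open import Defs
open import Data.Nat using (ℕ; zero; suc; _≤_; _<_; s≤s; z≤n)
open import Data.Nat.Properties using (≤-refl; ≤-trans; n≤1+n; 1+n≰n; ≤-pred; module ≤-Reasoning)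
open import Data.Fin using (Fin) renaming (zero to fzero; suc to fsuc)
open import Data.Fin.Subset using (Subset; _∈_; _∉_; _⊆_; _-_; _─_; ∣_∣; ⊥; Nonempty; inside; outside)
open import Data.Fin.Subset.Properties
  using (p─⊥≡p; p─q⊆p; x∈p∧x∉q⇒x∈p─q; nonempty?; Empty-unique; ∣⊥∣≡0; x∈p⇒∣p-x∣<∣p∣)
open import Data.Vec using (_∷_; there)
open import Data.Product using (Σ-syntax; _,_)
open import Data.Sum using (_⊎_; inj₁; inj₂)
open import Data.Empty using (⊥-elim)
open import Relation.Nullary using (yes; no)
open import Relation.Binary.PropositionalEquality using (_≡_; _≢_; refl; sym; subst)

∣p∣≤1+∣p-x∣ : ∀ {n} (p : Subset n) (x : Fin n) → ∣ p ∣ ≤ suc ∣ p - x ∣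
∣p∣≤1+∣p-x∣ (b ∷ p) fzero =
  subst (λ r → ∣ b ∷ p ∣ ≤ suc ∣ r ∣) (sym (p─⊥≡p p)) (∣b∷p∣≤1+∣p∣ b)
  where
  ∣b∷p∣≤1+∣p∣ : ∀ b → ∣ b ∷ p ∣ ≤ suc ∣ p ∣
  ∣b∷p∣≤1+∣p∣ inside  = ≤-refl
  ∣b∷p∣≤1+∣p∣ outside = n≤1+n ∣ p ∣
∣p∣≤1+∣p-x∣ (inside  ∷ p) (fsuc x) = s≤s (∣p∣≤1+∣p-x∣ p x)
∣p∣≤1+∣p-x∣ (outside ∷ p) (fsuc x) = ∣p∣≤1+∣p-x∣ p x

x∈p─q⇒x∉q : ∀ {n} {x : Fin n} (p q : Subset n) → x ∈ p ─ q → x ∉ q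
x∈p─q⇒x∉q (_ ∷ p) (inside  ∷ q) (there x∈p─q) (there x∈q) = x∈p─q⇒x∉q p q x∈p─q x∈q
x∈p─q⇒x∉q (_ ∷ p) (outside ∷ q) (there x∈p─q) (there x∈q) = x∈p─q⇒x∉q p q x∈p─q x∈q

─-monoˡ-⊆ : ∀ {n} {p q : Subset n} → p ⊆ q → ∀ r → p ─ r ⊆ q ─ r
─-monoˡ-⊆ {p = p} p⊆q r x∈p─r =
  x∈p∧x∉q⇒x∈p─q (p⊆q (p─q⊆p p r x∈p─r)) (x∈p─q⇒x∉q p r x∈p─r)

positive-size⇒nonempty : ∀ {n} (p : Subset n) → 1 ≤ ∣ p ∣ → Nonempty p
positive-size⇒nonempty {n} p 1≤∣p∣ with nonempty? p
... | yes p≢∅ = p≢∅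
... | no  p≡∅ = ⊥-elim (1+n≰n (subst (1 ≤_) size≡0 1≤∣p∣))
  where
  size≡0 : ∣ p ∣ ≡ 0
  size≡0 rewrite Empty-unique p≡∅ = ∣⊥∣≡0 n

distinct-pair-or-subsingleton : ∀ n →
  (Σ[ x ∈ Fin n ] Σ[ y ∈ Fin n ] x ≢ y) ⊎ (∀ (x y : Fin n) → x ≡ y)
distinct-pair-or-subsingleton zero          = inj₂ λ ()
distinct-pair-or-subsingleton (suc zero)    = inj₂ λ { fzero fzero → refl }
distinct-pair-or-subsingleton (suc (suc n)) = inj₁ (fzero , fsuc fzero , λ ())

module _ {n : ℕ} (G : Graph n) where

  generator-antitone : ∀ {k′ k} → k′ ≤ k → ∀ {S} →
    IsKMetricGenerator G k S → IsKMetricGenerator G k′ S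
  generator-antitone k′≤k genS x y x≢y with genS x y x≢y
  ... | T , T⊆S , k≤∣T∣ , distinguish = T , T⊆S , ≤-trans k′≤k k≤∣T∣ , distinguish

  -- Deleting a vertex v from a (k+1)-metric generator leaves a k-metric
  -- generator: each distinguishing set T loses at most v.
  generator-delete : ∀ {k S} (v : Fin n) →
    IsKMetricGenerator G (suc k) S → IsKMetricGenerator G k (S - v)
  generator-delete {k} {S} v genS x y x≢y with genS x y x≢y
  ... | T , T⊆S , 1+k≤∣T∣ , distinguish =
    T - v , T-v⊆S-v , k≤∣T-v∣ , (λ w∈T-v → distinguish (p─q⊆p T _ w∈T-v))
    where
    T-v⊆S-v : T - v ⊆ S - v
    T-v⊆S-v = ─-monoˡ-⊆ T⊆S _
    k≤∣T-v∣ : k ≤ ∣ T - v ∣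
    k≤∣T-v∣ = ≤-pred (≤-trans 1+k≤∣T∣ (∣p∣≤1+∣p-x∣ T v))

  generator-nonempty : ∀ {k S} {x y : Fin n} → x ≢ y →
    IsKMetricGenerator G (suc k) S → Nonempty S
  generator-nonempty {x = x} {y} x≢y genS with genS x y x≢y
  ... | T , T⊆S , 1+k≤∣T∣ , _ with positive-size⇒nonempty T (≤-trans (s≤s z≤n) 1+k≤∣T∣)
  ...   | w , w∈T = w , T⊆S w∈T

  subsingleton⇒generator : (∀ (x y : Fin n) → x ≡ y) →
    ∀ k S → IsKMetricGenerator G k S
  subsingleton⇒generator all-equal k S x y x≢y = ⊥-elim (x≢y (all-equal x y))

  -- A k-metric dimensional graph has two distinct vertices: otherwise it
  -- would have a (k+1)-metric generator, contradicting maximality of k.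
  dimensional⇒distinct-pair : ∀ {k} → KMetricDimensional G k →
    Σ[ x ∈ Fin n ] Σ[ y ∈ Fin n ] x ≢ y
  dimensional⇒distinct-pair {k} (_ , maximal) with distinct-pair-or-subsingleton n
  ... | inj₁ pair      = pair
  ... | inj₂ all-equal =
    ⊥-elim (1+n≰n (maximal (suc k) (⊥ , subsingleton⇒generator all-equal (suc k) ⊥)))

theorem12 : ∀ {n} (G : Graph n) (k : ℕ) → KMetricDimensional G k →
    ∀ k₁ k₂ → 1 ≤ k₁ → k₁ < k₂ → k₂ ≤ k →
    ∀ d₁ d₂ → IsKMetricDimension G k₁ d₁ → IsKMetricDimension G k₂ d₂ →
    d₁ < d₂
theorem12 G k dimensional k₁ k₂ _ k₁<k₂ _ d₁ d₂ (_ , d₁-minimal) ((S , genS , ∣S∣≡d₂) , _) =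
  let genS₁          = generator-antitone G k₁<k₂ genS
      _ , _ , x≢y    = dimensional⇒distinct-pair G dimensional
      v , v∈S        = generator-nonempty G x≢y genS₁
  in begin-strict
       d₁          ≤⟨ d₁-minimal (S - v) (generator-delete G v genS₁) ⟩
       ∣ S - v ∣   <⟨ x∈p⇒∣p-x∣<∣p∣ v∈S ⟩
       ∣ S ∣       ≡⟨ ∣S∣≡d₂ ⟩
       d₂          ∎
  where open ≤-Reasoning
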